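{- Let \[ F(x,y)=\sum_{n=0}^\infty\sum_{k=0}^\infty D_{2n}^{(-2k-1)}\frac{x^{2n}}{(2n)!}\frac{y^{2k}}{(2k)!}. \] Then, as formal power series in $x,y$, \[ F(x,y)=2\sum_{n=0}^\infty \frac{\partial}{\partial x}\left(\tanh^{2n+1}(x/2)\right)\cosh((2n+1)y). \]
   Context: For $k\in\mathbb{Z}$ let $\mathrm{A}_k(z)=2\sum_{n=0}^\infty \frac{z^{2n+1}}{(2n+1)^k}$, regarded as a formal power series. The poly-cosecant numbers $D_n^{(k)}$ are defined by $\frac{\mathrm{A}_k(\tanh(t/2))}{\sinh t}=\sum_{n\ge0} D_n^{(k)}\frac{t^n}{n!}$. -}

module Defs where

open import Data.Nat as ℕ using (ℕ; zero; suc; _!; _^_)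
open import Data.Nat.Properties using (_!≢0; m^n≢0)
open import Data.Integer as ℤ using (ℤ; +_; -[1+_])
open import Data.Rational using (ℚ; 0ℚ; 1ℚ; _+_; _*_; -_; _-_; _/_)
open import Data.Bool using (Bool; true; false; if_then_else_)

FPS : Set
FPS = ℕ → ℚ

-- Bivariate formal power series over ℚ: coefficient of x^a y^b.
FPS₂ : Set
FPS₂ = ℕ → ℕ → ℚ

sumTo : ℕ → (ℕ → ℚ) → ℚ
sumTo zero    f = f 0
sumTo (suc n) f = sumTo n f + f (suc n)

_^ℚ_ : ℚ → ℕ → ℚ
q ^ℚ zero  = 1ℚ
q ^ℚ suc n = q * (q ^ℚ n)

isEven : ℕ → Bool
isEven zero          = true
isEven (suc zero)    = false
isEven (suc (suc n)) = isEven n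

oneS : FPS
oneS zero    = 1ℚ
oneS (suc _) = 0ℚ

_·_ : FPS → FPS → FPS
(f · g) n = sumTo n (λ i → f i * g (n ℕ.∸ i))

_^S_ : FPS → ℕ → FPS
f ^S zero  = oneS
f ^S suc j = f · (f ^S j)

-- Composition a(g(t)), for g with zero constant term
-- (then g^j has order ≥ j, so only j ≤ n contribute to t^n).
_∘S_ : FPS → FPS → FPS
(a ∘S g) n = sumTo n (λ j → a j * (g ^S j) n)

-- Multiplicative inverse of u with constant term 1: 1/u = Σ_j (1 - u)^j.
invS : FPS → FPS
invS u = (λ _ → 1ℚ) ∘S (λ n → oneS n - u n)

∂ : FPS → FPS
∂ f n = (+ suc n / 1) * f (suc n)

scaleS : ℚ → FPS → FPS
scaleS c f n = (c ^ℚ n) * f n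

-- Division by t of a series with zero constant term
divT : FPS → FPS
divT f n = f (suc n)

expS : FPS
expS n = (+ 1 / (n !)) {{n !≢0}}

sinhS : FPS
sinhS n = if isEven n then 0ℚ else expS n

coshS : FPS
coshS n = if isEven n then expS n else 0ℚ

tanhHalfS : FPS
tanhHalfS = scaleS (+ 1 / 2) sinhS · invS (scaleS (+ 1 / 2) coshS)

recipPow : (m : ℕ) → ℤ → ℚ
recipPow m (+ k)    = (+ 1 / (suc (2 ℕ.* m) ^ k)) {{m^n≢0 (suc (2 ℕ.* m)) k}}
recipPow m -[1+ k ] = (+ (suc (2 ℕ.* m) ^ suc k)) / 1

-- oddSpread c : coefficient c j placed at t^(2j+1), zero at even powers
oddSpread : (ℕ → ℚ) → FPS
oddSpread c zero                = 0ℚ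
oddSpread c (suc zero)          = c 0
oddSpread c (suc (suc n))       = oddSpread (λ j → c (suc j)) n

-- A_k(z) = 2 Σ_{m≥0} z^{2m+1} / (2m+1)^k
A : ℤ → FPS
A k = oddSpread (λ m → (+ 2 / 1) * recipPow m k)

-- A_k(tanh(t/2)) / sinh t = Σ D_n^(k) t^n / n!
--   computed as (A_k(tanh(t/2)) / t) · (sinh t / t)^{-1}
D : ℕ → ℤ → ℚ
D n k = (+ (n !) / 1) * (divT (A k ∘S tanhHalfS) · invS (divT sinhS)) n

F : FPS₂
F a b = if isEven a then (if isEven b
          then D a (ℤ.- (+ (suc b))) * expS a * expS b
          else 0ℚ) else 0ℚ

-- The x-factor has order ≥ 2n, so for the coefficient of x^a only n ≤ a contribute;
-- the infinite (formally summable) sum is therefore the finite sum over n ≤ a.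
RHS : FPS₂
RHS a b = (+ 2 / 1) * sumTo a (λ n →
            ∂ (tanhHalfS ^S suc (2 ℕ.* n)) a
              * scaleS (+ suc (2 ℕ.* n) / 1) coshS b)

{-# OPTIONS --safe #-}
-- Write T = tanh(t/2). From sinh t = 2 sinh(t/2) cosh(t/2) and cosh²(t/2) = 1 + sinh²(t/2) one
-- gets sinh t · T′ = T, hence sinh t · (T^p)′ = p T^p. For k = -b-1 the series A_k(T) is
-- 2 Σ_m p_m^(b+1) T^(p_m) with p_m = 2m+1, so A_k(T)/sinh t = 2 Σ_m p_m^b (T^(p_m))′. The
-- coefficient of y^b/b! in cosh(p y) is p^b for even b and 0 for odd b, and since T is odd,
-- (T^p)′ is even for odd p. Identities between series are obtained from differential equations: a
-- series is determined by its derivative and its constant term.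
module Submission where

open import Defs
open import Algebra.Bundles using (CommutativeRing)
open import Algebra.Structures using (IsCommutativeSemiring)
import Algebra.Structures.Biased as Biased
open import Algebra.Solver.Ring.AlmostCommutativeRing
  using (AlmostCommutativeRing; _-Raw-AlmostCommutative⟶_)
import Algebra.Solver.Ring
open import Data.Bool using (true; false; not; if_then_else_)
open import Data.Bool.Properties using (not-involutive; not-injective)
open import Data.Integer using (+_; -[1+_])
import Data.Integer as ℤ
import Data.Integer.Properties as ℤₚ
import Data.Integer.Solver
open import Data.Maybe using (Maybe; just; nothing)
open import Data.Nat as ℕ using (ℕ; zero; suc; _∸_; _≤_; _<_; z≤n; s≤s; _!)
open import Data.Nat.Properties using (_!≢0)
import Data.Nat.Properties as ℕₚ
open import Data.Product using (_×_; _,_; proj₁; proj₂)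
open import Data.Rational using (ℚ; 0ℚ; 1ℚ; _+_; _*_; -_; _-_; _/_; toℚᵘ)
import Data.Rational.Properties as ℚₚ
import Data.Rational.Solver
import Data.Rational.Unnormalised as ℚᵘ
import Data.Rational.Unnormalised.Properties as ℚᵘₚ
open import Data.Sum using (inj₁; inj₂)
open import Relation.Binary.PropositionalEquality
open import Relation.Binary.Structures using (IsEquivalence)
open import Relation.Nullary using (yes; no)

module ℤ-Solver = Data.Integer.Solver.+-*-Solver
module ℚ-Solver = Data.Rational.Solver.+-*-Solver

toℚ : ℕ → ℚ
toℚ n = + n / 1

-- Division in ℚ normalises by a gcd, which does not compute on variables, so identities
-- between fractions are checked in the unnormalised rationals.
toℚᵘ-/ : ∀ i d .{{_ : ℕ.NonZero d}} → toℚᵘ (i / d) ℚᵘ.≃ (i ℚᵘ./ d)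
toℚᵘ-/ i (suc d) = ℚₚ.toℚᵘ-fromℚᵘ (ℚᵘ.mkℚᵘ i d)

toℚ-suc : ∀ n → toℚ (suc n) ≡ 1ℚ + toℚ n
toℚ-suc n = ℚₚ.toℚᵘ-injective (begin
  toℚᵘ (toℚ (suc n))                ≈⟨ toℚᵘ-/ (+ suc n) 1 ⟩
  + suc n ℚᵘ./ 1                    ≈⟨ ℚᵘ.*≡* (ℤ-Solver.solve 1 (λ x →
                                         (con (+ 1) :+ x) :* con (+ 1)
                                           := (con (+ 1) :* con (+ 1) :+ x :* con (+ 1)) :* con (+ 1))
                                         refl (+ n)) ⟩
  ℚᵘ.1ℚᵘ ℚᵘ.+ (+ n ℚᵘ./ 1)          ≈⟨ ℚᵘₚ.+-congʳ ℚᵘ.1ℚᵘ (toℚᵘ-/ (+ n) 1) ⟨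
  ℚᵘ.1ℚᵘ ℚᵘ.+ toℚᵘ (toℚ n)          ≈⟨ ℚₚ.toℚᵘ-homo-+ 1ℚ (toℚ n) ⟨
  toℚᵘ (1ℚ + toℚ n)                 ∎)
  where
  open ℚᵘₚ.≃-Reasoning
  open ℤ-Solver

toℚ[1+m]*1/[[1+m]*d]≡1/d : ∀ m d .{{_ : ℕ.NonZero d}} →
                            toℚ (suc m) * (+ 1 / (suc m ℕ.* d)) {{ℕₚ.m*n≢0 (suc m) d}} ≡ + 1 / d
toℚ[1+m]*1/[[1+m]*d]≡1/d m (suc d) = ℚₚ.toℚᵘ-injective (begin
  toℚᵘ (toℚ (suc m) * (+ 1 / (suc m ℕ.* suc d)))
    ≈⟨ ℚₚ.toℚᵘ-homo-* (toℚ (suc m)) (+ 1 / (suc m ℕ.* suc d)) ⟩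
  toℚᵘ (toℚ (suc m)) ℚᵘ.* toℚᵘ (+ 1 / (suc m ℕ.* suc d))
    ≈⟨ ℚᵘₚ.*-cong (toℚᵘ-/ (+ suc m) 1) (toℚᵘ-/ (+ 1) (suc m ℕ.* suc d)) ⟩
  (+ suc m ℚᵘ./ 1) ℚᵘ.* (+ 1 ℚᵘ./ (suc m ℕ.* suc d))
    ≈⟨ ℚᵘ.*≡* cross-multiplied ⟩
  + 1 ℚᵘ./ suc d
    ≈⟨ toℚᵘ-/ (+ 1) (suc d) ⟨
  toℚᵘ (+ 1 / suc d) ∎)
  where
  open ℚᵘₚ.≃-Reasoning
  cross-multiplied : (+ suc m ℤ.* + 1) ℤ.* + suc d ≡ + 1 ℤ.* + (1 ℕ.* (suc m ℕ.* suc d))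
  cross-multiplied = trans (cong (ℤ._* + suc d) (ℤₚ.*-identityʳ (+ suc m)))
    (trans (sym (ℤₚ.pos-* (suc m) (suc d)))
    (trans (cong +_ (sym (ℕₚ.*-identityˡ (suc m ℕ.* suc d))))
           (sym (ℤₚ.*-identityˡ (+ (1 ℕ.* (suc m ℕ.* suc d)))))))

open ≡-Reasoning

toℚ-+ : ∀ m n → toℚ (m ℕ.+ n) ≡ toℚ m + toℚ n
toℚ-+ zero    n = sym (ℚₚ.+-identityˡ (toℚ n))
toℚ-+ (suc m) n = begin
  toℚ (suc (m ℕ.+ n))    ≡⟨ toℚ-suc (m ℕ.+ n) ⟩
  1ℚ + toℚ (m ℕ.+ n)     ≡⟨ cong (λ x → 1ℚ + x) (toℚ-+ m n) ⟩
  1ℚ + (toℚ m + toℚ n)   ≡⟨ ℚₚ.+-assoc 1ℚ (toℚ m) (toℚ n) ⟨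
  (1ℚ + toℚ m) + toℚ n   ≡⟨ cong (_+ toℚ n) (toℚ-suc m) ⟨
  toℚ (suc m) + toℚ n    ∎

toℚ-* : ∀ m n → toℚ (m ℕ.* n) ≡ toℚ m * toℚ n
toℚ-* zero    n = sym (ℚₚ.*-zeroˡ (toℚ n))
toℚ-* (suc m) n = begin
  toℚ (n ℕ.+ m ℕ.* n)         ≡⟨ toℚ-+ n (m ℕ.* n) ⟩
  toℚ n + toℚ (m ℕ.* n)       ≡⟨ cong (λ x → toℚ n + x) (toℚ-* m n) ⟩
  toℚ n + toℚ m * toℚ n       ≡⟨ ℚ-Solver.solve 2 (λ x y → y :+ x :* y := (con 1ℚ :+ x) :* y)
                                   refl (toℚ m) (toℚ n) ⟩
  (1ℚ + toℚ m) * toℚ n        ≡⟨ cong (_* toℚ n) (toℚ-suc m) ⟨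
  toℚ (suc m) * toℚ n         ∎
  where open ℚ-Solver

toℚ-^ : ∀ p k → toℚ (p ℕ.^ k) ≡ toℚ p ^ℚ k
toℚ-^ p zero    = refl
toℚ-^ p (suc k) = trans (toℚ-* p (p ℕ.^ k)) (cong (toℚ p *_) (toℚ-^ p k))

toℚ-suc-*-expS-suc : ∀ n → toℚ (suc n) * expS (suc n) ≡ expS n
toℚ-suc-*-expS-suc n = toℚ[1+m]*1/[[1+m]*d]≡1/d n (n !) {{n !≢0}}

toℚ-!-*-expS : ∀ n → toℚ (n !) * expS n ≡ 1ℚ
toℚ-!-*-expS zero    = refl
toℚ-!-*-expS (suc n) = begin
  toℚ (suc n ℕ.* n !) * expS (suc n)      ≡⟨ cong (_* expS (suc n)) (toℚ-* (suc n) (n !)) ⟩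
  toℚ (suc n) * toℚ (n !) * expS (suc n)  ≡⟨ ℚ-Solver.solve 3 (λ x y z → (x :* y) :* z := y :* (x :* z))
                                                 refl (toℚ (suc n)) (toℚ (n !)) (expS (suc n)) ⟩
  toℚ (n !) * (toℚ (suc n) * expS (suc n)) ≡⟨ cong (toℚ (n !) *_) (toℚ-suc-*-expS-suc n) ⟩
  toℚ (n !) * expS n                      ≡⟨ toℚ-!-*-expS n ⟩
  1ℚ                                      ∎
  where open ℚ-Solver

toℚ-suc-*-cancelˡ : ∀ n {x y} → toℚ (suc n) * x ≡ toℚ (suc n) * y → x ≡ y
toℚ-suc-*-cancelˡ n {x} {y} eq = begin
  x               ≡⟨ ℚₚ.*-identityˡ x ⟨
  1ℚ * x          ≡⟨ cong (_* x) w*m≡1 ⟨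
  w * m * x       ≡⟨ ℚₚ.*-assoc w m x ⟩
  w * (m * x)     ≡⟨ cong (w *_) eq ⟩
  w * (m * y)     ≡⟨ ℚₚ.*-assoc w m y ⟨
  w * m * y       ≡⟨ cong (_* y) w*m≡1 ⟩
  1ℚ * y          ≡⟨ ℚₚ.*-identityˡ y ⟩
  y               ∎
  where
  m w : ℚ
  m = toℚ (suc n)
  w = expS (suc n) * toℚ (n !)
  w*m≡1 : w * m ≡ 1ℚ
  w*m≡1 = begin
    expS (suc n) * toℚ (n !) * m   ≡⟨ ℚ-Solver.solve 3 (λ e f k → e :* f :* k := f :* (k :* e))
                                        refl (expS (suc n)) (toℚ (n !)) m ⟩
    toℚ (n !) * (m * expS (suc n)) ≡⟨ cong (toℚ (n !) *_) (toℚ-suc-*-expS-suc n) ⟩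
    toℚ (n !) * expS n             ≡⟨ toℚ-!-*-expS n ⟩
    1ℚ                             ∎
    where open ℚ-Solver

isEven-suc : ∀ n → isEven (suc n) ≡ not (isEven n)
isEven-suc zero    = refl
isEven-suc (suc n) = sym (trans (cong not (isEven-suc n)) (not-involutive (isEven n)))

isEven-2* : ∀ n → isEven (2 ℕ.* n) ≡ true
isEven-2* zero    = refl
isEven-2* (suc n) = trans (cong isEven (ℕₚ.*-suc 2 n)) (isEven-2* n)

isEven-1+2* : ∀ n → isEven (suc (2 ℕ.* n)) ≡ false
isEven-1+2* n = trans (isEven-suc (2 ℕ.* n)) (cong not (isEven-2* n))

sumTo-cong : ∀ n {f g : ℕ → ℚ} → (∀ i → f i ≡ g i) → sumTo n f ≡ sumTo n g
sumTo-cong zero    f≡g = f≡g 0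
sumTo-cong (suc n) f≡g = cong₂ _+_ (sumTo-cong n f≡g) (f≡g (suc n))

sumTo-cong-≤ : ∀ n {f g : ℕ → ℚ} → (∀ i → i ≤ n → f i ≡ g i) → sumTo n f ≡ sumTo n g
sumTo-cong-≤ zero    f≡g = f≡g 0 z≤n
sumTo-cong-≤ (suc n) f≡g =
  cong₂ _+_ (sumTo-cong-≤ n (λ i i≤n → f≡g i (ℕₚ.m≤n⇒m≤1+n i≤n))) (f≡g (suc n) ℕₚ.≤-refl)

sumTo-zero : ∀ n (f : ℕ → ℚ) → (∀ i → i ≤ n → f i ≡ 0ℚ) → sumTo n f ≡ 0ℚ
sumTo-zero zero    f f≡0 = f≡0 0 z≤n
sumTo-zero (suc n) f f≡0 = begin
  sumTo n f + f (suc n) ≡⟨ cong₂ _+_ (sumTo-zero n f (λ i i≤n → f≡0 i (ℕₚ.m≤n⇒m≤1+n i≤n)))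
                                     (f≡0 (suc n) ℕₚ.≤-refl) ⟩
  0ℚ + 0ℚ               ≡⟨⟩
  0ℚ                    ∎

sumTo-+ : ∀ n (f g : ℕ → ℚ) → sumTo n (λ i → f i + g i) ≡ sumTo n f + sumTo n g
sumTo-+ zero    f g = refl
sumTo-+ (suc n) f g = begin
  sumTo n (λ i → f i + g i) + (f (suc n) + g (suc n))
    ≡⟨ cong (_+ (f (suc n) + g (suc n))) (sumTo-+ n f g) ⟩
  (sumTo n f + sumTo n g) + (f (suc n) + g (suc n))
    ≡⟨ ℚ-Solver.solve 4 (λ a b c d → (a :+ b) :+ (c :+ d) := (a :+ c) :+ (b :+ d))
         refl (sumTo n f) (sumTo n g) (f (suc n)) (g (suc n)) ⟩
  (sumTo n f + f (suc n)) + (sumTo n g + g (suc n)) ∎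
  where open ℚ-Solver

sumTo-*ˡ : ∀ n c (f : ℕ → ℚ) → sumTo n (λ i → c * f i) ≡ c * sumTo n f
sumTo-*ˡ zero    c f = refl
sumTo-*ˡ (suc n) c f = trans (cong (_+ c * f (suc n)) (sumTo-*ˡ n c f))
                             (sym (ℚₚ.*-distribˡ-+ c (sumTo n f) (f (suc n))))

sumTo-*ʳ : ∀ n c (f : ℕ → ℚ) → sumTo n (λ i → f i * c) ≡ sumTo n f * c
sumTo-*ʳ n c f = begin
  sumTo n (λ i → f i * c) ≡⟨ sumTo-cong n (λ i → ℚₚ.*-comm (f i) c) ⟩
  sumTo n (λ i → c * f i) ≡⟨ sumTo-*ˡ n c f ⟩
  c * sumTo n f           ≡⟨ ℚₚ.*-comm c (sumTo n f) ⟩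
  sumTo n f * c           ∎

sumTo-neg : ∀ n (f : ℕ → ℚ) → sumTo n (λ i → - f i) ≡ - sumTo n f
sumTo-neg zero    f = refl
sumTo-neg (suc n) f = trans (cong (_+ - f (suc n)) (sumTo-neg n f))
                            (sym (ℚₚ.neg-distrib-+ (sumTo n f) (f (suc n))))

sumTo-suc : ∀ n (f : ℕ → ℚ) → sumTo (suc n) f ≡ f 0 + sumTo n (λ i → f (suc i))
sumTo-suc zero    f = refl
sumTo-suc (suc n) f = begin
  sumTo (suc n) f + f (2 ℕ.+ n)
    ≡⟨ cong (_+ f (2 ℕ.+ n)) (sumTo-suc n f) ⟩
  (f 0 + sumTo n (λ i → f (suc i))) + f (2 ℕ.+ n)
    ≡⟨ ℚₚ.+-assoc (f 0) (sumTo n (λ i → f (suc i))) (f (2 ℕ.+ n)) ⟩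
  f 0 + sumTo (suc n) (λ i → f (suc i)) ∎

sumTo-reverse : ∀ n (f : ℕ → ℚ) → sumTo n f ≡ sumTo n (λ i → f (n ∸ i))
sumTo-reverse zero    f = refl
sumTo-reverse (suc n) f = begin
  sumTo n f + f (suc n)                   ≡⟨ cong (_+ f (suc n)) (sumTo-reverse n f) ⟩
  sumTo n (λ i → f (n ∸ i)) + f (suc n)   ≡⟨ ℚₚ.+-comm (sumTo n (λ i → f (n ∸ i))) (f (suc n)) ⟩
  f (suc n) + sumTo n (λ i → f (n ∸ i))   ≡⟨ sumTo-suc n (λ i → f (suc n ∸ i)) ⟨
  sumTo (suc n) (λ i → f (suc n ∸ i))     ∎

sumTo-comm : ∀ n m (H : ℕ → ℕ → ℚ) →
             sumTo n (λ i → sumTo m (H i)) ≡ sumTo m (λ j → sumTo n (λ i → H i j))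
sumTo-comm zero    m H = refl
sumTo-comm (suc n) m H = begin
  sumTo n (λ i → sumTo m (H i)) + sumTo m (H (suc n))
    ≡⟨ cong (_+ sumTo m (H (suc n))) (sumTo-comm n m H) ⟩
  sumTo m (λ j → sumTo n (λ i → H i j)) + sumTo m (H (suc n))
    ≡⟨ sumTo-+ m _ _ ⟨
  sumTo m (λ j → sumTo (suc n) (λ i → H i j)) ∎

sumTo-triangle : ∀ n (G : ℕ → ℕ → ℚ) →
                 sumTo n (λ i → sumTo i (λ j → G j (i ∸ j))) ≡ sumTo n (λ j → sumTo (n ∸ j) (G j))
sumTo-triangle zero    G = refl
sumTo-triangle (suc n) G = begin
  sumTo n (λ i → sumTo i (λ j → G j (i ∸ j))) + (sumTo n (λ j → G j (suc n ∸ j)) + G (suc n) (n ∸ n))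
    ≡⟨ cong₂ (λ u v → u + (sumTo n (λ j → G j (suc n ∸ j)) + G (suc n) v))
             (sumTo-triangle n G) (ℕₚ.n∸n≡0 n) ⟩
  sumTo n (λ j → sumTo (n ∸ j) (G j)) + (sumTo n (λ j → G j (suc n ∸ j)) + G (suc n) 0)
    ≡⟨ ℚₚ.+-assoc (sumTo n (λ j → sumTo (n ∸ j) (G j))) (sumTo n (λ j → G j (suc n ∸ j))) (G (suc n) 0) ⟨
  (sumTo n (λ j → sumTo (n ∸ j) (G j)) + sumTo n (λ j → G j (suc n ∸ j))) + G (suc n) 0
    ≡⟨ cong (_+ G (suc n) 0) (sumTo-+ n _ _) ⟨
  sumTo n (λ j → sumTo (n ∸ j) (G j) + G j (suc n ∸ j)) + G (suc n) 0
    ≡⟨ cong₂ _+_ (sumTo-cong-≤ n (λ j j≤n → extend (G j) (ℕₚ.+-∸-assoc 1 j≤n)))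
                 (cong (λ k → sumTo k (G (suc n))) (sym (ℕₚ.n∸n≡0 n))) ⟩
  sumTo n (λ j → sumTo (suc n ∸ j) (G j)) + sumTo (n ∸ n) (G (suc n)) ∎
  where
  extend : ∀ (g : ℕ → ℚ) {a b} → b ≡ suc a → sumTo a g + g b ≡ sumTo b g
  extend g refl = refl

sumTo-extend : ∀ (f : ℕ → ℚ) {m M} → m ≤ M → (∀ i → m < i → i ≤ M → f i ≡ 0ℚ) →
               sumTo M f ≡ sumTo m f
sumTo-extend f     {M = zero}  z≤n tail≡0 = refl
sumTo-extend f {m} {M = suc M} m≤M tail≡0 with ℕₚ.m≤n⇒m<n∨m≡n m≤M
... | inj₂ refl      = refl
... | inj₁ (s≤s m≤M) = begin
  sumTo M f + f (suc M) ≡⟨ cong₂ _+_ (sumTo-extend f m≤M (λ i m<i i≤M → tail≡0 i m<i (ℕₚ.m≤n⇒m≤1+n i≤M)))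
                                      (tail≡0 (suc M) (s≤s m≤M) ℕₚ.≤-refl) ⟩
  sumTo m f + 0ℚ        ≡⟨ ℚₚ.+-identityʳ (sumTo m f) ⟩
  sumTo m f             ∎

sumTo-pairs : ∀ N (g : ℕ → ℚ) →
              sumTo (suc (2 ℕ.* N)) g ≡ sumTo N (λ n → g (2 ℕ.* n) + g (suc (2 ℕ.* n)))
sumTo-pairs zero    g = refl
sumTo-pairs (suc N) g = begin
  sumTo (suc (2 ℕ.* suc N)) g
    ≡⟨ cong (λ m → sumTo (suc m) g) (ℕₚ.*-suc 2 N) ⟩
  sumTo (suc (2 ℕ.* N)) g + g (2 ℕ.+ 2 ℕ.* N) + g (3 ℕ.+ 2 ℕ.* N)
    ≡⟨ ℚₚ.+-assoc (sumTo (suc (2 ℕ.* N)) g) (g (2 ℕ.+ 2 ℕ.* N)) (g (3 ℕ.+ 2 ℕ.* N)) ⟩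
  sumTo (suc (2 ℕ.* N)) g + (g (2 ℕ.+ 2 ℕ.* N) + g (3 ℕ.+ 2 ℕ.* N))
    ≡⟨ cong₂ (λ s m → s + (g m + g (suc m))) (sumTo-pairs N g) (sym (ℕₚ.*-suc 2 N)) ⟩
  sumTo (suc N) (λ n → g (2 ℕ.* n) + g (suc (2 ℕ.* n))) ∎

-- The ring of formal power series

infix  4 _≈_
infixl 6 _⊕_
infix  8 ⊝_

_≈_ : FPS → FPS → Set
f ≈ g = ∀ n → f n ≡ g n

_⊕_ : FPS → FPS → FPS
(f ⊕ g) n = f n + g n

⊝_ : FPS → FPS
(⊝ f) n = - f n

0S : FPS
0S _ = 0ℚ

constS : ℚ → FPS
constS c zero    = c
constS c (suc _) = 0ℚ

≈-refl : ∀ {f} → f ≈ f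
≈-refl n = refl

≈-sym : ∀ {f g} → f ≈ g → g ≈ f
≈-sym f≈g n = sym (f≈g n)

≈-trans : ∀ {f g h} → f ≈ g → g ≈ h → f ≈ h
≈-trans f≈g g≈h n = trans (f≈g n) (g≈h n)

≈-isEquivalence : IsEquivalence _≈_
≈-isEquivalence = record { refl = ≈-refl ; sym = ≈-sym ; trans = ≈-trans }

⊕-cong : ∀ {f f′ g g′} → f ≈ f′ → g ≈ g′ → f ⊕ g ≈ f′ ⊕ g′
⊕-cong f≈f′ g≈g′ n = cong₂ _+_ (f≈f′ n) (g≈g′ n)

·-cong : ∀ {f f′ g g′} → f ≈ f′ → g ≈ g′ → f · g ≈ f′ · g′
·-cong f≈f′ g≈g′ n = sumTo-cong n (λ i → cong₂ _*_ (f≈f′ i) (g≈g′ (n ∸ i)))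

·-congˡ : ∀ f {g g′} → g ≈ g′ → f · g ≈ f · g′
·-congˡ f = ·-cong {f} {f} ≈-refl

·-congʳ : ∀ g {f f′} → f ≈ f′ → f · g ≈ f′ · g
·-congʳ g f≈f′ = ·-cong {g = g} {g′ = g} f≈f′ ≈-refl

·-coeff-cong-≤ : ∀ f {g g′} n → (∀ i → i ≤ n → g i ≡ g′ i) → (f · g) n ≡ (f · g′) n
·-coeff-cong-≤ f n g≡g′ = sumTo-cong n (λ i → cong (f i *_) (g≡g′ (n ∸ i) (ℕₚ.m∸n≤m n i)))

·-comm : ∀ f g → f · g ≈ g · f
·-comm f g n = begin
  sumTo n (λ i → f i * g (n ∸ i))               ≡⟨ sumTo-reverse n (λ i → f i * g (n ∸ i)) ⟩
  sumTo n (λ i → f (n ∸ i) * g (n ∸ (n ∸ i)))   ≡⟨ sumTo-cong-≤ n swap ⟩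
  sumTo n (λ i → g i * f (n ∸ i))               ∎
  where
  swap : ∀ i → i ≤ n → f (n ∸ i) * g (n ∸ (n ∸ i)) ≡ g i * f (n ∸ i)
  swap i i≤n = trans (cong (λ k → f (n ∸ i) * g k) (ℕₚ.m∸[m∸n]≡n i≤n)) (ℚₚ.*-comm (f (n ∸ i)) (g i))

·-assoc : ∀ f g h → (f · g) · h ≈ f · (g · h)
·-assoc f g h n = begin
  sumTo n (λ i → sumTo i (λ j → f j * g (i ∸ j)) * h (n ∸ i))
    ≡⟨ sumTo-cong n (λ i → sym (sumTo-*ʳ i (h (n ∸ i)) (λ j → f j * g (i ∸ j)))) ⟩
  sumTo n (λ i → sumTo i (λ j → f j * g (i ∸ j) * h (n ∸ i)))
    ≡⟨ sumTo-cong n (λ i → sumTo-cong-≤ i (λ j j≤i →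
         cong (λ k → f j * g (i ∸ j) * h (n ∸ k)) (sym (ℕₚ.m+[n∸m]≡n j≤i)))) ⟩
  sumTo n (λ i → sumTo i (λ j → G j (i ∸ j)))
    ≡⟨ sumTo-triangle n G ⟩
  sumTo n (λ j → sumTo (n ∸ j) (G j))
    ≡⟨ sumTo-cong n (λ j → trans (sumTo-cong (n ∸ j) (reassoc j)) (sumTo-*ˡ (n ∸ j) (f j) _)) ⟩
  sumTo n (λ j → f j * sumTo (n ∸ j) (λ k → g k * h (n ∸ j ∸ k))) ∎
  where
  G : ℕ → ℕ → ℚ
  G j k = f j * g k * h (n ∸ (j ℕ.+ k))
  reassoc : ∀ j k → G j k ≡ f j * (g k * h (n ∸ j ∸ k))
  reassoc j k = trans (ℚₚ.*-assoc (f j) (g k) (h (n ∸ (j ℕ.+ k))))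
                      (cong (λ m → f j * (g k * h m)) (sym (ℕₚ.∸-+-assoc n j k)))

·-distribʳ-⊕ : ∀ h f g → (f ⊕ g) · h ≈ f · h ⊕ g · h
·-distribʳ-⊕ h f g n = trans (sumTo-cong n (λ i → ℚₚ.*-distribʳ-+ (h (n ∸ i)) (f i) (g i)))
                            (sumTo-+ n (λ i → f i * h (n ∸ i)) (λ i → g i * h (n ∸ i)))

·-zeroˡ : ∀ f → 0S · f ≈ 0S
·-zeroˡ f n = sumTo-zero n _ (λ i _ → ℚₚ.*-zeroˡ (f (n ∸ i)))

constS-·-coeff : ∀ c g n → (constS c · g) n ≡ c * g n
constS-·-coeff c g zero    = refl
constS-·-coeff c g (suc n) = begin
  sumTo (suc n) (λ i → constS c i * g (suc n ∸ i))
    ≡⟨ sumTo-suc n (λ i → constS c i * g (suc n ∸ i)) ⟩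
  c * g (suc n) + sumTo n (λ i → 0ℚ * g (n ∸ i))
    ≡⟨ cong (λ z → c * g (suc n) + z) (sumTo-zero n _ (λ i _ → ℚₚ.*-zeroˡ (g (n ∸ i)))) ⟩
  c * g (suc n) + 0ℚ
    ≡⟨ ℚₚ.+-identityʳ (c * g (suc n)) ⟩
  c * g (suc n) ∎

oneS≈constS-1 : oneS ≈ constS 1ℚ
oneS≈constS-1 zero    = refl
oneS≈constS-1 (suc n) = refl

·-identityˡ : ∀ f → oneS · f ≈ f
·-identityˡ f n = trans (·-congʳ f oneS≈constS-1 n)
                        (trans (constS-·-coeff 1ℚ f n) (ℚₚ.*-identityˡ (f n)))

·-identityʳ : ∀ f → f · oneS ≈ f
·-identityʳ f = ≈-trans (·-comm f oneS) (·-identityˡ f)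

⊝-·ˡ : ∀ f g → (⊝ f) · g ≈ ⊝ (f · g)
⊝-·ˡ f g n = trans (sumTo-cong n (λ i → sym (ℚₚ.neg-distribˡ-* (f i) (g (n ∸ i)))))
                   (sumTo-neg n (λ i → f i * g (n ∸ i)))

·-isCommutativeSemiring : IsCommutativeSemiring _≈_ _⊕_ _·_ 0S oneS
·-isCommutativeSemiring = Biased.IsCommutativeSemiringˡ.isCommutativeSemiring (record
  { +-isCommutativeMonoid = record
    { isMonoid = record
      { isSemigroup = record
        { isMagma = record { isEquivalence = ≈-isEquivalence ; ∙-cong = ⊕-cong }
        ; assoc   = λ f g h n → ℚₚ.+-assoc (f n) (g n) (h n) }
      ; identity = (λ f n → ℚₚ.+-identityˡ (f n)) , (λ f n → ℚₚ.+-identityʳ (f n)) }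
    ; comm = λ f g n → ℚₚ.+-comm (f n) (g n) }
  ; *-isCommutativeMonoid = record
    { isMonoid = record
      { isSemigroup = record
        { isMagma = record { isEquivalence = ≈-isEquivalence ; ∙-cong = ·-cong }
        ; assoc   = ·-assoc }
      ; identity = ·-identityˡ , ·-identityʳ }
    ; comm = ·-comm }
  ; distribʳ = ·-distribʳ-⊕
  ; zeroˡ    = ·-zeroˡ })

FPS-almostCommutativeRing : AlmostCommutativeRing _ _
FPS-almostCommutativeRing = record
  { Carrier = FPS ; _≈_ = _≈_ ; _+_ = _⊕_ ; _*_ = _·_ ; -_ = ⊝_ ; 0# = 0S ; 1# = oneS
  ; isAlmostCommutativeRing = record
    { isCommutativeSemiring = ·-isCommutativeSemiring
    ; -‿cong                = λ f≈g n → cong -_ (f≈g n)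
    ; -‿*-distribˡ          = ⊝-·ˡ
    ; -‿+-comm              = λ f g n → sym (ℚₚ.neg-distrib-+ (f n) (g n)) } }

constS-cong : ∀ {a b} → a ≡ b → constS a ≈ constS b
constS-cong refl = ≈-refl

constS-+ : ∀ a b → constS (a + b) ≈ constS a ⊕ constS b
constS-+ a b zero    = refl
constS-+ a b (suc n) = refl

constS-* : ∀ a b → constS (a * b) ≈ constS a · constS b
constS-* a b n = sym (trans (constS-·-coeff a (constS b) n) (lemma n))
  where
  lemma : ∀ n → a * constS b n ≡ constS (a * b) n
  lemma zero    = refl
  lemma (suc n) = ℚₚ.*-zeroʳ a

constS-morphism : CommutativeRing.rawRing ℚₚ.+-*-commutativeRing
                    -Raw-AlmostCommutative⟶ FPS-almostCommutativeRing
constS-morphism = record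
  { ⟦_⟧    = constS
  ; +-homo = constS-+
  ; *-homo = constS-*
  ; -‿homo = λ { a zero → refl ; a (suc n) → refl }
  ; 0-homo = λ { zero → refl ; (suc n) → refl }
  ; 1-homo = λ { zero → refl ; (suc n) → refl } }

constS-≟ : ∀ a b → Maybe (constS a ≈ constS b)
constS-≟ a b with a ℚₚ.≟ b
... | yes refl = just ≈-refl
... | no _     = nothing

module FPS-Solver = Algebra.Solver.Ring _ FPS-almostCommutativeRing constS-morphism constS-≟

-- The formal derivative

∂-cong : ∀ {f g} → f ≈ g → ∂ f ≈ ∂ g
∂-cong f≈g n = cong (toℚ (suc n) *_) (f≈g (suc n))

∂-⊕ : ∀ f g {f′ g′} → ∂ f ≈ f′ → ∂ g ≈ g′ → ∂ (f ⊕ g) ≈ f′ ⊕ g′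
∂-⊕ f g ∂f ∂g n =
  trans (ℚₚ.*-distribˡ-+ (toℚ (suc n)) (f (suc n)) (g (suc n))) (cong₂ _+_ (∂f n) (∂g n))

∂-constS : ∀ c → ∂ (constS c) ≈ constS 0ℚ
∂-constS c zero    = ℚₚ.*-zeroʳ (toℚ 1)
∂-constS c (suc n) = ℚₚ.*-zeroʳ (toℚ (2 ℕ.+ n))

∂-oneS : ∂ oneS ≈ constS 0ℚ
∂-oneS = ≈-trans (∂-cong oneS≈constS-1) (∂-constS 1ℚ)

∂-scaleS : ∀ c f → ∂ (scaleS c f) ≈ constS c · scaleS c (∂ f)
∂-scaleS c f n = begin
  toℚ (suc n) * (c * c ^ℚ n * f (suc n))
    ≡⟨ ℚ-Solver.solve 4 (λ i c p x → i :* ((c :* p) :* x) := c :* (p :* (i :* x)))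
         refl (toℚ (suc n)) c (c ^ℚ n) (f (suc n)) ⟩
  c * (c ^ℚ n * (toℚ (suc n) * f (suc n)))
    ≡⟨ constS-·-coeff c (scaleS c (∂ f)) n ⟨
  (constS c · scaleS c (∂ f)) n ∎
  where open ℚ-Solver

∂-·-coeff : ∀ f g n → ∂ (f · g) n ≡ (∂ f · g ⊕ f · ∂ g) n
∂-·-coeff f g n = begin
  toℚ (suc n) * sumTo (suc n) (λ i → f i * g (suc n ∸ i))
    ≡⟨ sumTo-*ˡ (suc n) (toℚ (suc n)) _ ⟨
  sumTo (suc n) (λ i → toℚ (suc n) * (f i * g (suc n ∸ i)))
    ≡⟨ sumTo-cong-≤ (suc n) split ⟩
  sumTo (suc n) (λ i → left i + right i)
    ≡⟨ sumTo-+ (suc n) left right ⟩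
  sumTo (suc n) left + sumTo (suc n) right
    ≡⟨ cong₂ _+_ left-sum right-sum ⟩
  (∂ f · g) n + (f · ∂ g) n ∎
  where
  left right : ℕ → ℚ
  left  i = toℚ i * (f i * g (suc n ∸ i))
  right i = toℚ (suc n ∸ i) * (f i * g (suc n ∸ i))

  split : ∀ i → i ≤ suc n → toℚ (suc n) * (f i * g (suc n ∸ i)) ≡ left i + right i
  split i i≤ = trans (cong (λ k → toℚ k * (f i * g (suc n ∸ i))) (sym (ℕₚ.m+[n∸m]≡n i≤)))
                     (trans (cong (_* (f i * g (suc n ∸ i))) (toℚ-+ i (suc n ∸ i)))
                            (ℚₚ.*-distribʳ-+ (f i * g (suc n ∸ i)) (toℚ i) (toℚ (suc n ∸ i))))

  left-sum : sumTo (suc n) left ≡ (∂ f · g) n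
  left-sum = begin
    sumTo (suc n) left                          ≡⟨ sumTo-suc n left ⟩
    0ℚ * (f 0 * g (suc n)) + sumTo n (λ i → left (suc i))
      ≡⟨ cong (_+ sumTo n (λ i → left (suc i))) (ℚₚ.*-zeroˡ (f 0 * g (suc n))) ⟩
    0ℚ + sumTo n (λ i → left (suc i))           ≡⟨ ℚₚ.+-identityˡ _ ⟩
    sumTo n (λ i → left (suc i))
      ≡⟨ sumTo-cong n (λ i → sym (ℚₚ.*-assoc (toℚ (suc i)) (f (suc i)) (g (n ∸ i)))) ⟩
    (∂ f · g) n                                 ∎

  right-sum : sumTo (suc n) right ≡ (f · ∂ g) n
  right-sum = begin
    sumTo n right + right (suc n)
      ≡⟨ cong (λ x → sumTo n right + x) (trans (cong (λ k → toℚ k * (f (suc n) * g k)) (ℕₚ.n∸n≡0 n))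
                                         (ℚₚ.*-zeroˡ (f (suc n) * g 0))) ⟩
    sumTo n right + 0ℚ     ≡⟨ ℚₚ.+-identityʳ _ ⟩
    sumTo n right          ≡⟨ sumTo-cong-≤ n (λ i i≤n → trans
                                 (cong (λ k → toℚ k * (f i * g k)) (ℕₚ.+-∸-assoc 1 i≤n))
                                 (ℚ-Solver.solve 3 (λ x y z → x :* (y :* z) := y :* (x :* z))
                                    refl (toℚ (suc (n ∸ i))) (f i) (g (suc (n ∸ i))))) ⟩
    (f · ∂ g) n            ∎
    where open ℚ-Solver

∂-· : ∀ f g {f′ g′} → ∂ f ≈ f′ → ∂ g ≈ g′ → ∂ (f · g) ≈ f′ · g ⊕ f · g′
∂-· f g ∂f ∂g = ≈-trans (∂-·-coeff f g) (⊕-cong (·-congʳ g ∂f) (·-congˡ f ∂g))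

∂-^S : ∀ f m → ∂ (f ^S suc m) ≈ constS (toℚ (suc m)) · ((f ^S m) · ∂ f)
∂-^S f zero n = begin
  ∂ (f · oneS) n                               ≡⟨ ∂-cong (·-identityʳ f) n ⟩
  ∂ f n                                        ≡⟨ ·-identityˡ (∂ f) n ⟨
  (oneS · ∂ f) n                               ≡⟨ ℚₚ.*-identityˡ _ ⟨
  toℚ 1 * (oneS · ∂ f) n                       ≡⟨ constS-·-coeff (toℚ 1) (oneS · ∂ f) n ⟨
  (constS (toℚ 1) · (oneS · ∂ f)) n            ∎
∂-^S f (suc m) = ≈-trans (∂-· f (f ^S suc m) ≈-refl (∂-^S f m)) (≈-trans
  (solve 4 (λ F P d K → d :* (F :* P) :+ F :* (K :* (P :* d)) := (con 1ℚ :+ K) :* ((F :* P) :* d))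
     ≈-refl f (f ^S m) (∂ f) (constS (toℚ (suc m))))
  (·-congʳ ((f ^S suc m) · ∂ f)
     (≈-sym (≈-trans (constS-cong (toℚ-suc (suc m))) (constS-+ 1ℚ (toℚ (suc m)))))))
  where open FPS-Solver

∂-unique : ∀ {f g} → ∂ f ≈ ∂ g → f 0 ≡ g 0 → f ≈ g
∂-unique ∂f≈∂g f₀≡g₀ zero    = f₀≡g₀
∂-unique ∂f≈∂g f₀≡g₀ (suc n) = toℚ-suc-*-cancelˡ n (∂f≈∂g n)

∂-unique-pair : ∀ {u U v V} → ∂ u ≈ v → ∂ U ≈ V → ∂ v ≈ u → ∂ V ≈ U →
                u 0 ≡ U 0 → v 0 ≡ V 0 → u ≈ U × v ≈ V
∂-unique-pair {u} {U} {v} {V} ∂u ∂U ∂v ∂V u₀ v₀ = (λ n → proj₁ (both n)) , (λ n → proj₂ (both n))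
  where
  both : ∀ n → u n ≡ U n × v n ≡ V n
  both zero    = u₀ , v₀
  both (suc n) = toℚ-suc-*-cancelˡ n (trans (∂u n) (trans (proj₂ (both n)) (sym (∂U n))))
               , toℚ-suc-*-cancelˡ n (trans (∂v n) (trans (proj₁ (both n)) (sym (∂V n))))

½ : ℚ
½ = + 1 / 2

sinhHalfS coshHalfS : FPS
sinhHalfS = scaleS ½ sinhS
coshHalfS = scaleS ½ coshS

∂-sinhS : ∂ sinhS ≈ coshS
∂-sinhS n = trans (cong (λ b → toℚ (suc n) * (if b then 0ℚ else expS (suc n))) (isEven-suc n))
                  (by-parity (isEven n))
  where
  by-parity : ∀ b → toℚ (suc n) * (if not b then 0ℚ else expS (suc n)) ≡ (if b then expS n else 0ℚ)
  by-parity true  = toℚ-suc-*-expS-suc n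
  by-parity false = ℚₚ.*-zeroʳ (toℚ (suc n))

∂-coshS : ∂ coshS ≈ sinhS
∂-coshS n = trans (cong (λ b → toℚ (suc n) * (if b then expS (suc n) else 0ℚ)) (isEven-suc n))
                  (by-parity (isEven n))
  where
  by-parity : ∀ b → toℚ (suc n) * (if not b then expS (suc n) else 0ℚ) ≡ (if b then 0ℚ else expS n)
  by-parity true  = ℚₚ.*-zeroʳ (toℚ (suc n))
  by-parity false = toℚ-suc-*-expS-suc n

∂-sinhHalfS : ∂ sinhHalfS ≈ constS ½ · coshHalfS
∂-sinhHalfS = ≈-trans (∂-scaleS ½ sinhS) (·-congˡ (constS ½) (λ n → cong (½ ^ℚ n *_) (∂-sinhS n)))

∂-coshHalfS : ∂ coshHalfS ≈ constS ½ · sinhHalfS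
∂-coshHalfS = ≈-trans (∂-scaleS ½ coshS) (·-congˡ (constS ½) (λ n → cong (½ ^ℚ n *_) (∂-coshS n)))

coshHalfS²≈1+sinhHalfS² : coshHalfS · coshHalfS ≈ constS 1ℚ ⊕ sinhHalfS · sinhHalfS
coshHalfS²≈1+sinhHalfS² = ∂-unique (≈-trans (∂-· coshHalfS coshHalfS ∂-coshHalfS ∂-coshHalfS) (≈-trans
  (solve 2 (λ s c → (con ½ :* s) :* c :+ c :* (con ½ :* s)
                  := con 0ℚ :+ ((con ½ :* c) :* s :+ s :* (con ½ :* c))) ≈-refl sinhHalfS coshHalfS)
  (≈-sym (∂-⊕ (constS 1ℚ) (sinhHalfS · sinhHalfS) (∂-constS 1ℚ)
                (∂-· sinhHalfS sinhHalfS ∂-sinhHalfS ∂-sinhHalfS))))) refl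
  where open FPS-Solver

-- Both sides, together with cosh t and its doubling formula, solve u′ = v, v′ = u.
sinhS≈2sinhHalfS·coshHalfS : sinhS ≈ constS (toℚ 2) · (sinhHalfS · coshHalfS)
sinhS≈2sinhHalfS·coshHalfS = proj₁ (∂-unique-pair ∂-sinhS ∂-double ∂-coshS ∂-sum refl refl)
  where
  open FPS-Solver
  double sum : FPS
  double = constS (toℚ 2) · (sinhHalfS · coshHalfS)
  sum    = coshHalfS · coshHalfS ⊕ sinhHalfS · sinhHalfS

  ∂-double : ∂ double ≈ sum
  ∂-double = ≈-trans
    (∂-· (constS (toℚ 2)) (sinhHalfS · coshHalfS) (∂-constS (toℚ 2))
         (∂-· sinhHalfS coshHalfS ∂-sinhHalfS ∂-coshHalfS))
    (solve 2 (λ s c → con 0ℚ :* (s :* c) :+ con (toℚ 2) :* ((con ½ :* c) :* c :+ s :* (con ½ :* s))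
                    := c :* c :+ s :* s) ≈-refl sinhHalfS coshHalfS)

  ∂-sum : ∂ sum ≈ double
  ∂-sum = ≈-trans
    (∂-⊕ (coshHalfS · coshHalfS) (sinhHalfS · sinhHalfS)
         (∂-· coshHalfS coshHalfS ∂-coshHalfS ∂-coshHalfS) (∂-· sinhHalfS sinhHalfS ∂-sinhHalfS ∂-sinhHalfS))
    (solve 2 (λ s c → ((con ½ :* s) :* c :+ c :* (con ½ :* s))
                      :+ ((con ½ :* c) :* s :+ s :* (con ½ :* c))
                    := con (toℚ 2) :* (s :* c)) ≈-refl sinhHalfS coshHalfS)

^S-cong : ∀ {f g} m → f ≈ g → f ^S m ≈ g ^S m
^S-cong zero    f≈g = ≈-refl
^S-cong (suc m) f≈g = ·-cong f≈g (^S-cong m f≈g)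

^S-coeff-< : ∀ g → g 0 ≡ 0ℚ → ∀ j n → n < j → (g ^S j) n ≡ 0ℚ
^S-coeff-< g g₀≡0 (suc j) n (s≤s n≤j) = sumTo-zero n _ vanishes
  where
  vanishes : ∀ i → i ≤ n → g i * (g ^S j) (n ∸ i) ≡ 0ℚ
  vanishes zero    _ = trans (cong (_* (g ^S j) n) g₀≡0) (ℚₚ.*-zeroˡ ((g ^S j) n))
  vanishes (suc i) 1+i≤n = trans (cong (g (suc i) *_) (^S-coeff-< g g₀≡0 j (n ∸ suc i) n∸1+i<j))
                                 (ℚₚ.*-zeroʳ (g (suc i)))
    where
    n∸1+i<j : n ∸ suc i < j
    n∸1+i<j = ℕₚ.<-≤-trans (ℕₚ.∸-monoʳ-< {n} {suc i} {0} (s≤s z≤n) 1+i≤n) n≤j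

divT-·ˡ : ∀ f g → f 0 ≡ 0ℚ → divT (f · g) ≈ divT f · g
divT-·ˡ f g f₀≡0 n = begin
  sumTo (suc n) (λ i → f i * g (suc n ∸ i))
    ≡⟨ sumTo-suc n (λ i → f i * g (suc n ∸ i)) ⟩
  f 0 * g (suc n) + (divT f · g) n
    ≡⟨ cong (λ x → x * g (suc n) + (divT f · g) n) f₀≡0 ⟩
  0ℚ * g (suc n) + (divT f · g) n
    ≡⟨ cong (_+ (divT f · g) n) (ℚₚ.*-zeroˡ (g (suc n))) ⟩
  0ℚ + (divT f · g) n
    ≡⟨ ℚₚ.+-identityˡ _ ⟩
  (divT f · g) n ∎

module _ (u : FPS) (u₀≡1 : u 0 ≡ 1ℚ) where

  private
    w : FPS
    w n = oneS n - u n

    w₀≡0 : w 0 ≡ 0ℚ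
    w₀≡0 = cong (λ x → 1ℚ - x) u₀≡1

    geometric : FPS
    geometric n = sumTo n (λ j → (w ^S j) n)

    invS≈geometric : invS u ≈ geometric
    invS≈geometric n = sumTo-cong n (λ j → ℚₚ.*-identityˡ ((w ^S j) n))

    w·geometric : ∀ n → (w · geometric) n ≡ sumTo n (λ j → (w ^S suc j) n)
    w·geometric n = begin
      sumTo n (λ i → w i * sumTo (n ∸ i) (λ j → (w ^S j) (n ∸ i)))
        ≡⟨ sumTo-cong n (λ i → cong (w i *_) (sym (sumTo-extend (λ j → (w ^S j) (n ∸ i)) (ℕₚ.m∸n≤m n i)
               (λ j lt _ → ^S-coeff-< w w₀≡0 j (n ∸ i) lt)))) ⟩
      sumTo n (λ i → w i * sumTo n (λ j → (w ^S j) (n ∸ i)))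
        ≡⟨ sumTo-cong n (λ i → sym (sumTo-*ˡ n (w i) (λ j → (w ^S j) (n ∸ i)))) ⟩
      sumTo n (λ i → sumTo n (λ j → w i * (w ^S j) (n ∸ i)))
        ≡⟨ sumTo-comm n n (λ i j → w i * (w ^S j) (n ∸ i)) ⟩
      sumTo n (λ j → (w ^S suc j) n) ∎

    geometric-recurrence : ∀ n → (w · geometric) n + oneS n ≡ geometric n
    geometric-recurrence zero    = cong (λ x → x * 1ℚ + 1ℚ) w₀≡0
    geometric-recurrence (suc n) = begin
      (w · geometric) (suc n) + 0ℚ
        ≡⟨ ℚₚ.+-identityʳ _ ⟩
      (w · geometric) (suc n)
        ≡⟨ w·geometric (suc n) ⟩
      sumTo n (λ j → (w ^S suc j) (suc n)) + (w ^S (2 ℕ.+ n)) (suc n)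
        ≡⟨ cong (λ x → sumTo n (λ j → (w ^S suc j) (suc n)) + x)
                (^S-coeff-< w w₀≡0 (2 ℕ.+ n) (suc n) ℕₚ.≤-refl) ⟩
      sumTo n (λ j → (w ^S suc j) (suc n)) + 0ℚ
        ≡⟨ ℚₚ.+-identityʳ _ ⟩
      sumTo n (λ j → (w ^S suc j) (suc n))
        ≡⟨ ℚₚ.+-identityˡ _ ⟨
      0ℚ + sumTo n (λ j → (w ^S suc j) (suc n))
        ≡⟨ sumTo-suc n (λ j → (w ^S j) (suc n)) ⟨
      geometric (suc n) ∎

  invS-inverseʳ : u · invS u ≈ oneS
  invS-inverseʳ n = begin
    (u · invS u) n                            ≡⟨ ·-cong u≈1-w invS≈geometric n ⟩
    ((oneS ⊕ ⊝ w) · geometric) n              ≡⟨ ·-distribʳ-⊕ geometric oneS (⊝ w) n ⟩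
    (oneS · geometric) n + ((⊝ w) · geometric) n
      ≡⟨ cong₂ (λ x y → x + y) (·-identityˡ geometric n) (⊝-·ˡ w geometric n) ⟩
    geometric n - (w · geometric) n           ≡⟨ cong (_- (w · geometric) n) (geometric-recurrence n) ⟨
    (w · geometric) n + oneS n - (w · geometric) n
      ≡⟨ ℚ-Solver.solve 2 (λ a b → a :+ b :- a := b) refl ((w · geometric) n) (oneS n) ⟩
    oneS n                                    ∎
    where
    open ℚ-Solver using (_:+_; _:-_; _:=_)
    u≈1-w : u ≈ oneS ⊕ ⊝ w
    u≈1-w n = ℚ-Solver.solve 2 (λ x y → x := y :- (y :- x)) refl (u n) (oneS n)

·-invS-coeff : ∀ s y r a → s 0 ≡ 1ℚ → (∀ i → i ≤ a → y i ≡ (s · r) i) → (y · invS s) a ≡ r a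
·-invS-coeff s y r a s₀≡1 y≡s·r = begin
  (y · invS s) a             ≡⟨ ·-comm y (invS s) a ⟩
  (invS s · y) a             ≡⟨ ·-coeff-cong-≤ (invS s) a y≡s·r ⟩
  (invS s · (s · r)) a       ≡⟨ ·-assoc (invS s) s r a ⟨
  ((invS s · s) · r) a       ≡⟨ ·-congʳ r (≈-trans (·-comm (invS s) s) (invS-inverseʳ s s₀≡1)) a ⟩
  (oneS · r) a               ≡⟨ ·-identityˡ r a ⟩
  r a                        ∎

-- The series tanh(t/2)

divT-cong : ∀ {f g} → f ≈ g → divT f ≈ divT g
divT-cong f≈g n = f≈g (suc n)

tanhHalfS₀≡0 : tanhHalfS 0 ≡ 0ℚ
tanhHalfS₀≡0 = ℚₚ.*-zeroˡ (invS coshHalfS 0)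

-- Differentiate cosh(t/2) · cosh(t/2)⁻¹ = 1.
coshHalfS·∂invS : coshHalfS · ∂ (invS coshHalfS) ≈ ⊝ (constS ½ · tanhHalfS)
coshHalfS·∂invS = ≈-trans
  (solve 4 (λ s c i d → c :* d := ((con ½ :* s) :* i :+ c :* d) :+ (:- (con ½ :* (s :* i))))
     ≈-refl sinhHalfS coshHalfS (invS coshHalfS) (∂ (invS coshHalfS)))
  (≈-trans (⊕-cong ∂[coshHalfS·invS]≈0 ≈-refl)
  (solve 2 (λ s i → con 0ℚ :+ (:- (con ½ :* (s :* i))) := :- (con ½ :* (s :* i)))
     ≈-refl sinhHalfS (invS coshHalfS)))
  where
  open FPS-Solver
  ∂[coshHalfS·invS]≈0 : (constS ½ · sinhHalfS) · invS coshHalfS ⊕ coshHalfS · ∂ (invS coshHalfS)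
                          ≈ constS 0ℚ
  ∂[coshHalfS·invS]≈0 = ≈-trans (≈-sym (∂-· coshHalfS (invS coshHalfS) ∂-coshHalfS ≈-refl))
                                (≈-trans (∂-cong (invS-inverseʳ coshHalfS refl)) ∂-oneS)

sinhS·∂tanhHalfS : sinhS · ∂ tanhHalfS ≈ tanhHalfS
sinhS·∂tanhHalfS = ≈-trans
  (·-cong sinhS≈2sinhHalfS·coshHalfS (∂-· sinhHalfS (invS coshHalfS) ∂-sinhHalfS ≈-refl))
  (≈-trans
  (solve 4 (λ s c i d → (con (toℚ 2) :* (s :* c)) :* ((con ½ :* c) :* i :+ s :* d)
                      := (s :* i) :* (c :* c) :+ (con (toℚ 2) :* (s :* s)) :* (c :* d))
     ≈-refl sinhHalfS coshHalfS (invS coshHalfS) (∂ (invS coshHalfS)))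
  (≈-trans
  (⊕-cong (·-congˡ tanhHalfS coshHalfS²≈1+sinhHalfS²)
          (·-congˡ (constS (toℚ 2) · (sinhHalfS · sinhHalfS)) coshHalfS·∂invS))
  (solve 2 (λ s i → (s :* i) :* (con 1ℚ :+ s :* s)
                      :+ (con (toℚ 2) :* (s :* s)) :* (:- (con ½ :* (s :* i)))
                  := s :* i)
     ≈-refl sinhHalfS (invS coshHalfS))))
  where
  open FPS-Solver

divT-sinhS·∂tanhHalfS^S : ∀ m → divT sinhS · ∂ (tanhHalfS ^S suc m)
                                  ≈ constS (toℚ (suc m)) · divT (tanhHalfS ^S suc m)
divT-sinhS·∂tanhHalfS^S m = ≈-trans (·-congˡ (divT sinhS) (∂-^S T m)) (≈-trans
  (solve 4 (λ S K P d → S :* (K :* (P :* d)) := K :* (P :* (S :* d)))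
     ≈-refl (divT sinhS) (constS (toℚ (suc m))) (T ^S m) (∂ T))
  (·-congˡ (constS (toℚ (suc m))) (≈-trans (·-congˡ (T ^S m) divT-sinhS·∂T) (≈-trans
    (·-comm (T ^S m) (divT T)) (≈-sym (divT-·ˡ T (T ^S m) tanhHalfS₀≡0))))))
  where
  open FPS-Solver
  T : FPS
  T = tanhHalfS
  divT-sinhS·∂T : divT sinhS · ∂ T ≈ divT T
  divT-sinhS·∂T = ≈-trans (≈-sym (divT-·ˡ sinhS (∂ T) refl)) (divT-cong sinhS·∂tanhHalfS)

^ℚ-+ : ∀ c i k → c ^ℚ (i ℕ.+ k) ≡ c ^ℚ i * c ^ℚ k
^ℚ-+ c zero    k = sym (ℚₚ.*-identityˡ (c ^ℚ k))
^ℚ-+ c (suc i) k = trans (cong (c *_) (^ℚ-+ c i k)) (sym (ℚₚ.*-assoc c (c ^ℚ i) (c ^ℚ k)))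

scaleS-cong : ∀ c {f g} → f ≈ g → scaleS c f ≈ scaleS c g
scaleS-cong c f≈g n = cong (c ^ℚ n *_) (f≈g n)

scaleS-oneS : ∀ c → scaleS c oneS ≈ oneS
scaleS-oneS c zero    = refl
scaleS-oneS c (suc n) = ℚₚ.*-zeroʳ (c ^ℚ suc n)

scaleS-· : ∀ c f g → scaleS c (f · g) ≈ scaleS c f · scaleS c g
scaleS-· c f g n = trans (sym (sumTo-*ˡ n (c ^ℚ n) _)) (sumTo-cong-≤ n distribute)
  where
  distribute : ∀ i → i ≤ n → c ^ℚ n * (f i * g (n ∸ i)) ≡ (c ^ℚ i * f i) * (c ^ℚ (n ∸ i) * g (n ∸ i))
  distribute i i≤n = begin
    c ^ℚ n * (f i * g (n ∸ i))
      ≡⟨ cong (λ k → c ^ℚ k * (f i * g (n ∸ i))) (sym (ℕₚ.m+[n∸m]≡n i≤n)) ⟩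
    c ^ℚ (i ℕ.+ (n ∸ i)) * (f i * g (n ∸ i))
      ≡⟨ cong (_* (f i * g (n ∸ i))) (^ℚ-+ c i (n ∸ i)) ⟩
    c ^ℚ i * c ^ℚ (n ∸ i) * (f i * g (n ∸ i))
      ≡⟨ ℚ-Solver.solve 4 (λ a b x y → (a :* b) :* (x :* y) := (a :* x) :* (b :* y))
           refl (c ^ℚ i) (c ^ℚ (n ∸ i)) (f i) (g (n ∸ i)) ⟩
    (c ^ℚ i * f i) * (c ^ℚ (n ∸ i) * g (n ∸ i)) ∎
    where open ℚ-Solver

scaleS-^S : ∀ c f m → scaleS c (f ^S m) ≈ scaleS c f ^S m
scaleS-^S c f zero    = scaleS-oneS c
scaleS-^S c f (suc m) = ≈-trans (scaleS-· c f (f ^S m)) (·-congˡ (scaleS c f) (scaleS-^S c f m))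

invS-unique : ∀ u v → u 0 ≡ 1ℚ → u · v ≈ oneS → v ≈ invS u
invS-unique u v u₀≡1 u·v≈1 = ≈-trans (≈-sym (·-identityˡ v)) (≈-trans
  (·-congʳ v (≈-sym (≈-trans (·-comm (invS u) u) (invS-inverseʳ u u₀≡1)))) (≈-trans
  (·-assoc (invS u) u v) (≈-trans
  (·-congˡ (invS u) u·v≈1)
  (·-identityʳ (invS u)))))

scaleS-invS : ∀ c u → u 0 ≡ 1ℚ → scaleS c (invS u) ≈ invS (scaleS c u)
scaleS-invS c u u₀≡1 = invS-unique (scaleS c u) (scaleS c (invS u))
  (trans (ℚₚ.*-identityˡ (u 0)) u₀≡1)
  (≈-trans (≈-sym (scaleS-· c u (invS u)))
           (≈-trans (scaleS-cong c (invS-inverseʳ u u₀≡1)) (scaleS-oneS c)))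

reflectS : FPS → FPS
reflectS = scaleS (- 1ℚ)

[-1]^ℚ-even : ∀ n → isEven n ≡ true → (- 1ℚ) ^ℚ n ≡ 1ℚ
[-1]^ℚ-odd  : ∀ n → isEven n ≡ false → (- 1ℚ) ^ℚ n ≡ - 1ℚ

[-1]^ℚ-even zero    _ = refl
[-1]^ℚ-even (suc n) e =
  cong (- 1ℚ *_) ([-1]^ℚ-odd n (not-injective {isEven n} {false} (trans (sym (isEven-suc n)) e)))

[-1]^ℚ-odd (suc n) e =
  cong (- 1ℚ *_) ([-1]^ℚ-even n (not-injective {isEven n} {true} (trans (sym (isEven-suc n)) e)))

reflectS-even : ∀ f → (∀ n → isEven n ≡ false → f n ≡ 0ℚ) → reflectS f ≈ f
reflectS-even f odd≡0 n with isEven n in parity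
... | true  = trans (cong (_* f n) ([-1]^ℚ-even n parity)) (ℚₚ.*-identityˡ (f n))
... | false = trans (cong ((- 1ℚ) ^ℚ n *_) (odd≡0 n parity))
                    (trans (ℚₚ.*-zeroʳ ((- 1ℚ) ^ℚ n)) (sym (odd≡0 n parity)))

reflectS-odd : ∀ f → (∀ n → isEven n ≡ true → f n ≡ 0ℚ) → reflectS f ≈ ⊝ f
reflectS-odd f even≡0 n with isEven n in parity
... | true  = trans (cong ((- 1ℚ) ^ℚ n *_) (even≡0 n parity))
                    (trans (ℚₚ.*-zeroʳ ((- 1ℚ) ^ℚ n)) (cong -_ (sym (even≡0 n parity))))
... | false = trans (cong (_* f n) ([-1]^ℚ-odd n parity))
                    (ℚ-Solver.solve 1 (λ x → con (- 1ℚ) :* x := :- x) refl (f n))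
  where open ℚ-Solver

x≡-x⇒x≡0 : ∀ {x} → x ≡ - x → x ≡ 0ℚ
x≡-x⇒x≡0 {x} x≡-x = begin
  x               ≡⟨ ℚ-Solver.solve 1 (λ x → x := con ½ :* (x :+ x)) refl x ⟩
  ½ * (x + x)     ≡⟨ cong (λ y → ½ * (x + y)) x≡-x ⟩
  ½ * (x + - x)   ≡⟨ ℚ-Solver.solve 1 (λ x → con ½ :* (x :+ :- x) := con 0ℚ) refl x ⟩
  0ℚ              ∎
  where open ℚ-Solver

⊝-^S : ∀ f m → (⊝ f) ^S m ≈ constS ((- 1ℚ) ^ℚ m) · (f ^S m)
⊝-^S f zero    = ≈-sym (≈-trans (·-congʳ oneS (≈-sym oneS≈constS-1)) (·-identityˡ oneS))
⊝-^S f (suc m) = ≈-trans (·-congˡ (⊝ f) (⊝-^S f m)) (≈-trans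
  (solve 3 (λ F K P → (:- F) :* (K :* P) := (con (- 1ℚ) :* K) :* (F :* P))
     ≈-refl f (constS ((- 1ℚ) ^ℚ m)) (f ^S m))
  (·-congʳ (f ^S suc m) (≈-sym (constS-* (- 1ℚ) ((- 1ℚ) ^ℚ m)))))
  where open FPS-Solver

odd-^S-even-coeff : ∀ f m e → reflectS f ≈ ⊝ f → isEven m ≡ false → isEven e ≡ true →
                    (f ^S m) e ≡ 0ℚ
odd-^S-even-coeff f m e f-odd m-odd e-even = x≡-x⇒x≡0 (begin
  (f ^S m) e                         ≡⟨ ℚₚ.*-identityˡ _ ⟨
  1ℚ * (f ^S m) e                    ≡⟨ cong (_* (f ^S m) e) ([-1]^ℚ-even e e-even) ⟨
  reflectS (f ^S m) e                ≡⟨ scaleS-^S (- 1ℚ) f m e ⟩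
  (reflectS f ^S m) e                ≡⟨ ^S-cong m f-odd e ⟩
  ((⊝ f) ^S m) e                     ≡⟨ ⊝-^S f m e ⟩
  (constS ((- 1ℚ) ^ℚ m) · (f ^S m)) e  ≡⟨ constS-·-coeff ((- 1ℚ) ^ℚ m) (f ^S m) e ⟩
  (- 1ℚ) ^ℚ m * (f ^S m) e           ≡⟨ cong (_* (f ^S m) e) ([-1]^ℚ-odd m m-odd) ⟩
  - 1ℚ * (f ^S m) e                  ≡⟨ ℚ-Solver.solve 1 (λ x → con (- 1ℚ) :* x := :- x)
                                            refl ((f ^S m) e) ⟩
  - (f ^S m) e                       ∎)
  where open ℚ-Solver using (con; _:*_; :-_; _:=_)

reflectS-tanhHalfS : reflectS tanhHalfS ≈ ⊝ tanhHalfS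
reflectS-tanhHalfS = ≈-trans (scaleS-· (- 1ℚ) sinhHalfS (invS coshHalfS)) (≈-trans
  (·-cong (reflectS-odd sinhHalfS sinhHalfS-even≡0)
          (≈-trans (scaleS-invS (- 1ℚ) coshHalfS refl)
                   (invS-unique coshHalfS (invS (reflectS coshHalfS)) refl
                      (≈-trans (·-congʳ (invS (reflectS coshHalfS))
                                        (≈-sym (reflectS-even coshHalfS coshHalfS-odd≡0)))
                               (invS-inverseʳ (reflectS coshHalfS) refl)))))
  (⊝-·ˡ sinhHalfS (invS coshHalfS)))
  where
  sinhHalfS-even≡0 : ∀ n → isEven n ≡ true → sinhHalfS n ≡ 0ℚ
  sinhHalfS-even≡0 n e = trans (cong (λ b → ½ ^ℚ n * (if b then 0ℚ else expS n)) e) (ℚₚ.*-zeroʳ (½ ^ℚ n))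
  coshHalfS-odd≡0 : ∀ n → isEven n ≡ false → coshHalfS n ≡ 0ℚ
  coshHalfS-odd≡0 n e = trans (cong (λ b → ½ ^ℚ n * (if b then expS n else 0ℚ)) e) (ℚₚ.*-zeroʳ (½ ^ℚ n))

-- The poly-cosecant numbers of negative odd index

sumS : ℕ → (ℕ → FPS) → FPS
sumS N F m = sumTo N (λ n → F n m)

·-sumS : ∀ f N (F : ℕ → FPS) → f · sumS N F ≈ sumS N (λ n → f · F n)
·-sumS f N F m = trans (sumTo-cong m (λ i → sym (sumTo-*ˡ N (f i) (λ n → F n (m ∸ i)))))
                       (sumTo-comm m N (λ i n → f i * F n (m ∸ i)))

oddSpread-odd : ∀ n (c : ℕ → ℚ) → oddSpread c (suc (2 ℕ.* n)) ≡ c n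
oddSpread-odd zero    c = refl
oddSpread-odd (suc n) c =
  trans (cong (λ m → oddSpread c (suc m)) (ℕₚ.*-suc 2 n)) (oddSpread-odd n (λ j → c (suc j)))

oddSpread-even : ∀ n (c : ℕ → ℚ) → oddSpread c (2 ℕ.* n) ≡ 0ℚ
oddSpread-even zero    c = refl
oddSpread-even (suc n) c =
  trans (cong (oddSpread c) (ℕₚ.*-suc 2 n)) (oddSpread-even n (λ j → c (suc j)))

odd : ℕ → ℕ
odd n = suc (2 ℕ.* n)

weight : ℕ → ℕ → ℚ
weight b n = toℚ 2 * toℚ (odd n) ^ℚ b

A-odd : ∀ b n x → A -[1+ b ] (odd n) * x ≡ weight b n * (toℚ (odd n) * x)
A-odd b n x = begin
  A -[1+ b ] (odd n) * x
    ≡⟨ cong (_* x) (oddSpread-odd n _) ⟩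
  toℚ 2 * toℚ (odd n ℕ.^ suc b) * x
    ≡⟨ cong (λ y → toℚ 2 * y * x) (toℚ-* (odd n) (odd n ℕ.^ b)) ⟩
  toℚ 2 * (toℚ (odd n) * toℚ (odd n ℕ.^ b)) * x
    ≡⟨ cong (λ y → toℚ 2 * (toℚ (odd n) * y) * x) (toℚ-^ (odd n) b) ⟩
  toℚ 2 * (toℚ (odd n) * toℚ (odd n) ^ℚ b) * x
    ≡⟨ ℚ-Solver.solve 4 (λ t q r y → t :* (q :* r) :* y := (t :* r) :* (q :* y))
         refl (toℚ 2) (toℚ (odd n)) (toℚ (odd n) ^ℚ b) x ⟩
  weight b n * (toℚ (odd n) * x) ∎
  where open ℚ-Solver

A-even : ∀ b n x → A -[1+ b ] (2 ℕ.* n) * x ≡ 0ℚ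
A-even b n x = trans (cong (_* x) (oddSpread-even n _)) (ℚₚ.*-zeroˡ x)

divT-A∘tanhHalfS : ∀ b a i → i ≤ a →
                   divT (A -[1+ b ] ∘S tanhHalfS) i
                     ≡ sumTo a (λ n → weight b n * (toℚ (odd n) * (tanhHalfS ^S odd n) (suc i)))
divT-A∘tanhHalfS b a i i≤a = begin
  sumTo (suc i) term
    ≡⟨ sumTo-extend term (s≤s (ℕₚ.≤-trans i≤a (ℕₚ.m≤m+n a (a ℕ.+ 0)))) high-powers-vanish ⟨
  sumTo (suc (2 ℕ.* a)) term
    ≡⟨ sumTo-pairs a term ⟩
  sumTo a (λ n → term (2 ℕ.* n) + term (odd n))
    ≡⟨ sumTo-cong a (λ n → cong₂ _+_ (A-even b n _) (A-odd b n _)) ⟩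
  sumTo a (λ n → 0ℚ + weight b n * (toℚ (odd n) * (tanhHalfS ^S odd n) (suc i)))
    ≡⟨ sumTo-cong a (λ n → ℚₚ.+-identityˡ _) ⟩
  sumTo a (λ n → weight b n * (toℚ (odd n) * (tanhHalfS ^S odd n) (suc i))) ∎
  where
  -- Only T^j with j ≤ i+1 reach t^(i+1); padding to 2a+1 terms allows splitting by parity of j.
  term : ℕ → ℚ
  term j = A -[1+ b ] j * (tanhHalfS ^S j) (suc i)
  high-powers-vanish : ∀ j → suc i < j → j ≤ suc (2 ℕ.* a) → term j ≡ 0ℚ
  high-powers-vanish j i<j _ =
    trans (cong (A -[1+ b ] j *_) (^S-coeff-< tanhHalfS tanhHalfS₀≡0 j (suc i) i<j))
          (ℚₚ.*-zeroʳ (A -[1+ b ] j))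

divT-sinhS·weighted : ∀ (w : ℕ → ℚ) a i →
  (divT sinhS · sumS a (λ n → constS (w n) · ∂ (tanhHalfS ^S odd n))) i
    ≡ sumTo a (λ n → w n * (toℚ (odd n) * (tanhHalfS ^S odd n) (suc i)))
divT-sinhS·weighted w a i =
  trans (·-sumS (divT sinhS) a (λ n → constS (w n) · ∂ (T ^S odd n)) i) (sumTo-cong a (λ n → begin
  (divT sinhS · (constS (w n) · ∂ (T ^S odd n))) i
    ≡⟨ solve 3 (λ S K P → S :* (K :* P) := K :* (S :* P))
         ≈-refl (divT sinhS) (constS (w n)) (∂ (T ^S odd n)) i ⟩
  (constS (w n) · (divT sinhS · ∂ (T ^S odd n))) i
    ≡⟨ constS-·-coeff (w n) (divT sinhS · ∂ (T ^S odd n)) i ⟩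
  w n * (divT sinhS · ∂ (T ^S odd n)) i
    ≡⟨ cong (w n *_) (divT-sinhS·∂tanhHalfS^S (2 ℕ.* n) i) ⟩
  w n * (constS (toℚ (odd n)) · divT (T ^S odd n)) i
    ≡⟨ cong (w n *_) (constS-·-coeff (toℚ (odd n)) (divT (T ^S odd n)) i) ⟩
  w n * (toℚ (odd n) * (T ^S odd n) (suc i)) ∎))
  where
  open FPS-Solver
  T : FPS
  T = tanhHalfS

D-negative : ∀ a b → D a -[1+ b ] ≡ toℚ (a !) * sumTo a (λ n → weight b n * ∂ (tanhHalfS ^S odd n) a)
D-negative a b = cong (toℚ (a !) *_) (begin
  (divT (A -[1+ b ] ∘S tanhHalfS) · invS (divT sinhS)) a
    ≡⟨ ·-invS-coeff (divT sinhS) _ weighted a refl (λ i i≤a →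
         trans (divT-A∘tanhHalfS b a i i≤a) (sym (divT-sinhS·weighted (weight b) a i))) ⟩
  weighted a
    ≡⟨ sumTo-cong a (λ n → constS-·-coeff (weight b n) (∂ (tanhHalfS ^S odd n)) a) ⟩
  sumTo a (λ n → weight b n * ∂ (tanhHalfS ^S odd n) a) ∎)
  where
  weighted : FPS
  weighted = sumS a (λ n → constS (weight b n) · ∂ (tanhHalfS ^S odd n))

F-even : ∀ a b → isEven a ≡ true → isEven b ≡ true → F a b ≡ D a -[1+ b ] * expS a * expS b
F-even a b a-even b-even rewrite a-even | b-even = refl

F-odd-left : ∀ a b → isEven a ≡ false → F a b ≡ 0ℚ
F-odd-left a b a-odd rewrite a-odd = refl

F-odd-right : ∀ a b → isEven b ≡ false → F a b ≡ 0ℚ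
F-odd-right a b b-odd with isEven a
... | true  rewrite b-odd = refl
... | false = refl

∂-tanhHalfS^S-odd-coeff : ∀ n a → isEven a ≡ false → ∂ (tanhHalfS ^S odd n) a ≡ 0ℚ
∂-tanhHalfS^S-odd-coeff n a a-odd =
  trans (cong (toℚ (suc a) *_) (odd-^S-even-coeff tanhHalfS (odd n) (suc a) reflectS-tanhHalfS
                                  (isEven-1+2* n) (trans (isEven-suc a) (cong not a-odd))))
        (ℚₚ.*-zeroʳ (toℚ (suc a)))

RHS-zero : ∀ a b → (∀ n → ∂ (tanhHalfS ^S odd n) a * scaleS (toℚ (odd n)) coshS b ≡ 0ℚ) → RHS a b ≡ 0ℚ
RHS-zero a b terms≡0 = trans (cong (toℚ 2 *_) (sumTo-zero a _ (λ n _ → terms≡0 n))) (ℚₚ.*-zeroʳ (toℚ 2))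

RHS-odd-left : ∀ a b → isEven a ≡ false → RHS a b ≡ 0ℚ
RHS-odd-left a b a-odd = RHS-zero a b (λ n →
  trans (cong (_* scaleS (toℚ (odd n)) coshS b) (∂-tanhHalfS^S-odd-coeff n a a-odd))
        (ℚₚ.*-zeroˡ (scaleS (toℚ (odd n)) coshS b)))

RHS-odd-right : ∀ a b → isEven b ≡ false → RHS a b ≡ 0ℚ
RHS-odd-right a b b-odd = RHS-zero a b (λ n →
  trans (cong (λ x → ∂ (tanhHalfS ^S odd n) a * (toℚ (odd n) ^ℚ b * (if x then expS b else 0ℚ))) b-odd)
        (ℚ-Solver.solve 2 (λ d p → d :* (p :* con 0ℚ) := con 0ℚ) refl
           (∂ (tanhHalfS ^S odd n) a) (toℚ (odd n) ^ℚ b)))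
  where open ℚ-Solver

RHS-even-right : ∀ a b → isEven b ≡ true →
                 RHS a b ≡ sumTo a (λ n → weight b n * ∂ (tanhHalfS ^S odd n) a) * expS b
RHS-even-right a b b-even = begin
  toℚ 2 * sumTo a (λ n → ∂ (T ^S odd n) a * (toℚ (odd n) ^ℚ b * coshS b))
    ≡⟨ sumTo-*ˡ a (toℚ 2) _ ⟨
  sumTo a (λ n → toℚ 2 * (∂ (T ^S odd n) a * (toℚ (odd n) ^ℚ b * coshS b)))
    ≡⟨ sumTo-cong a (λ n → cong (λ x → toℚ 2 * (∂ (T ^S odd n) a
                                                 * (toℚ (odd n) ^ℚ b * (if x then expS b else 0ℚ))))
                                b-even) ⟩
  sumTo a (λ n → toℚ 2 * (∂ (T ^S odd n) a * (toℚ (odd n) ^ℚ b * expS b)))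
    ≡⟨ sumTo-cong a (λ n → ℚ-Solver.solve 4 (λ t d q e → t :* (d :* (q :* e)) := (t :* q) :* d :* e)
                             refl (toℚ 2) (∂ (T ^S odd n) a) (toℚ (odd n) ^ℚ b) (expS b)) ⟩
  sumTo a (λ n → weight b n * ∂ (T ^S odd n) a * expS b)
    ≡⟨ sumTo-*ʳ a (expS b) _ ⟩
  sumTo a (λ n → weight b n * ∂ (T ^S odd n) a) * expS b ∎
  where
  open ℚ-Solver
  T : FPS
  T = tanhHalfS

lemma3p5 : (a b : ℕ) → F a b ≡ RHS a b
lemma3p5 a b = by-parity (isEven a) (isEven b) refl refl
  where
  Σ : ℚ
  Σ = sumTo a (λ n → weight b n * ∂ (tanhHalfS ^S odd n) a)

  by-parity : ∀ x y → isEven a ≡ x → isEven b ≡ y → F a b ≡ RHS a b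
  by-parity false _    a-odd _ = trans (F-odd-left a b a-odd) (sym (RHS-odd-left a b a-odd))
  by-parity true false _ b-odd = trans (F-odd-right a b b-odd) (sym (RHS-odd-right a b b-odd))
  by-parity true true a-even b-even = begin
    F a b                                     ≡⟨ F-even a b a-even b-even ⟩
    D a -[1+ b ] * expS a * expS b            ≡⟨ cong (λ x → x * expS a * expS b) (D-negative a b) ⟩
    toℚ (a !) * Σ * expS a * expS b           ≡⟨ ℚ-Solver.solve 4
                                                   (λ f s e g → f :* s :* e :* g := (f :* e) :* (s :* g))
                                                   refl (toℚ (a !)) Σ (expS a) (expS b) ⟩
    toℚ (a !) * expS a * (Σ * expS b)         ≡⟨ cong (_* (Σ * expS b)) (toℚ-!-*-expS a) ⟩
    1ℚ * (Σ * expS b)                         ≡⟨ ℚₚ.*-identityˡ (Σ * expS b) ⟩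
    Σ * expS b                                ≡⟨ RHS-even-right a b b-even ⟨
    RHS a b                                   ∎
    where open ℚ-Solver
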